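{- Let $\Gamma=(\mathcal{P},\mathcal{L},\mathtt{I})$ be a finite weak generalised $2m$-gon of order $(s,t)$, $m\ge2$, with $s\le t$. Let $C$ be a set of $s+1$ points and let $x$ be an element of $\Gamma$ such that for some $d\in\{1,\dots,2m-2\}$: $\mathcal{P}_{\le d-2}(x)\cap C=\emptyset$, and $\mathcal{P}_{d-1}(y)\cap C\ne\emptyset$ for every $y\in\Gamma_1(x)$. Then $C\subseteq\mathcal{P}_d(x)$, and if $x$ is a point then $s=t$.
   Context: A weak generalised $n$-gon ($n\ge3$) is a point-line geometry (points, lines, symmetric incidence; elements are points or lines) with no ordinary $k$-gon as subgeometry for $2\le k<n$ and in which any two elements lie in a common ordinary $n$-gon. $\delta$ is distance in the bipartite incidence graph. Order $(s,t)$: each line has exactly $s+1$ points, each point is on exactly $t+1$ lines. $\Gamma_1(x)$ is the set of elements incident with $x$; $\mathcal{P}_i(x)$, $\mathcal{P}_{\le i}(x)$ are the sets of points at distance exactly $i$, resp. at most $i$, from $x$ (empty for negative $i$). -}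

module Defs where

open import Data.Nat using (ℕ; zero; suc; _+_; _*_; _≤_; _<_; NonZero)
open import Data.Nat.DivMod using (_%_; m%n<n)
open import Data.Fin using (Fin; toℕ; fromℕ<)
open import Data.Fin.Subset using (Subset; ∣_∣; _∈_)
open import Data.Vec using (tabulate)
open import Data.Bool using (Bool; true; false; T)
open import Data.Sum using (_⊎_; inj₁; inj₂)
open import Data.Product using (Σ; ∃; _×_; _,_)
open import Data.Empty using (⊥)
open import Data.Unit using (⊤)
open import Relation.Nullary using (¬_)
open import Relation.Binary.PropositionalEquality using (_≡_)
open import Function.Definitions using (Injective)

record Geometry : Set where
  field
    np nl : ℕ
    I     : Fin np → Fin nl → Bool

module _ (Γ : Geometry) where
  open Geometry Γ

  Elem : Set
  Elem = Fin np ⊎ Fin nl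

  Adj : Elem → Elem → Set
  Adj (inj₁ p) (inj₂ L) = T (I p L)
  Adj (inj₂ L) (inj₁ p) = T (I p L)
  Adj (inj₁ _) (inj₁ _) = ⊥
  Adj (inj₂ _) (inj₂ _) = ⊥

  Γ₁ : Elem → Elem → Set
  Γ₁ x y = Adj x y

  data Walk : Elem → Elem → ℕ → Set where
    here : ∀ {x} → Walk x x 0
    step : ∀ {x y z n} → Adj x y → Walk y z n → Walk x z (suc n)

  Dist≤ : Elem → Elem → ℕ → Set
  Dist≤ x y i = Σ ℕ λ j → j ≤ i × Walk x y j

  Dist≡ : Elem → Elem → ℕ → Set
  Dist≡ x y i = Walk x y i × (∀ j → j < i → ¬ Walk x y j)

  InP : ℕ → Elem → Fin np → Set
  InP i x p = Dist≡ x (inj₁ p) i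

  csuc : ∀ {n} → Fin n → Fin n
  csuc {suc n} i = fromℕ< (m%n<n (suc (toℕ i)) (suc n))

  record OrdinaryGon (k : ℕ) : Set where
    field
      vert  : Fin (2 * k) → Elem
      inj   : Injective _≡_ _≡_ vert
      cycle : ∀ i → Adj (vert i) (vert (csuc i))

  record WeakGenPolygon (n : ℕ) : Set where
    field
      three≤n  : 3 ≤ n
      noSmall  : ∀ k → 2 ≤ k → k < n → ¬ OrdinaryGon k
      common   : ∀ (x y : Elem) → Σ (OrdinaryGon n) λ G →
                   (∃ λ i → OrdinaryGon.vert G i ≡ x) ×
                   (∃ λ j → OrdinaryGon.vert G j ≡ y)

  pointsOn : Fin nl → Subset np
  pointsOn L = tabulate (λ p → I p L)

  linesThrough : Fin np → Subset nl
  linesThrough p = tabulate (λ L → I p L)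

  HasOrder : ℕ → ℕ → Set
  HasOrder s t = (∀ L → ∣ pointsOn L ∣ ≡ suc s) × (∀ p → ∣ linesThrough p ∣ ≡ suc t)

  IsPoint : Elem → Set
  IsPoint (inj₁ _) = ⊤
  IsPoint (inj₂ _) = ⊥

{-# OPTIONS --safe #-}
-- For y ∈ Γ₁(x) pick p_y ∈ C ∩ 𝒫_{d-1}(y). No point of C is within d - 2 of x, and walks
-- between two fixed elements all have the same parity, so δ(x, p_y) = d. If p_y = p_y′ with
-- y ≠ y′, the two shortest walks x, y, …, p_y and x, y′, …, p_y split at x and, followed to the
-- first element where they meet again, close up into an ordinary j-gon with 2 ≤ j ≤ d < 2m,
-- which a weak generalised 2m-gon does not contain. Hence y ↦ p_y injects Γ₁(x), of size
-- s + 1 or t + 1 ≥ s + 1 = |C|, into C; so it is onto C, and for a point x also t ≤ s.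

module Submission where

open import Defs
open import Data.Bool using (Bool; true; false; not; T)
open import Data.Bool.Properties using (not-¬)
open import Data.Fin as Fin using (Fin; toℕ)
open import Data.Fin.Properties as Finₚ using (toℕ-injective; toℕ-fromℕ<; toℕ<n)
open import Data.Fin.Subset using (Subset; ∣_∣; _∈_; _-_; inside; outside)
open import Data.Fin.Subset.Properties using (x∈p⇒∣p-x∣<∣p∣; x∈p∧x≢y⇒x∈p-y)
open import Data.Nat using (ℕ; zero; suc; _+_; _*_; _∸_; _≤_; _<_; z≤n; s≤s; s≤s⁻¹; _≤?_)
open import Data.Nat.DivMod using (_%_; m<n⇒m%n≡m; n%n≡0)
open import Data.Nat.GeneralisedArithmetic using (fold; iterate; iterate-is-fold)
open import Data.Nat.Properties
open import Data.Product using (Σ; ∃-syntax; _×_; _,_; proj₁; proj₂)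
open import Data.Sum using (_⊎_; inj₁; inj₂)
open import Data.Sum.Properties using (≡-dec; inj₁-injective; inj₂-injective)
open import Data.Unit using (tt)
open import Data.Vec.Base using ([]; _∷_; tabulate; here; there)
open import Data.Vec.Properties using ([]=⇒lookup; lookup∘tabulate)
open import Function using (_∘_)
open import Function.Definitions using (Injective)
open import Relation.Nullary using (¬_; yes; no; contradiction)
open import Relation.Unary using (Decidable)
open import Relation.Binary.PropositionalEquality

least-witness : ∀ {P : ℕ → Set} → Decidable P → ∀ {n} → P n →
                ∃[ j ] j ≤ n × P j × (∀ {i} → i < j → ¬ P i)
least-witness P? {zero} p = 0 , z≤n , p , λ ()
least-witness P? {suc n} p with P? 0
... | yes p₀ = 0 , z≤n , p₀ , λ ()
... | no ¬p₀ with least-witness (P? ∘ suc) p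
...   | j , j≤n , pj , below = suc j , s≤s j≤n , pj , λ { {zero} _ → ¬p₀ ; {suc i} (s≤s i<j) → below i<j }

∈-tabulate⁻ : ∀ {n} {f : Fin n → Bool} {i} → i ∈ tabulate f → T (f i)
∈-tabulate⁻ {f = f} {i} i∈ = subst T (sym (trans (sym (lookup∘tabulate f i)) ([]=⇒lookup i∈))) tt

record SubsetInjection {a b} (S : Subset a) (C : Subset b) : Set where
  field
    apply     : ∀ i → i ∈ S → Fin b
    apply-∈   : ∀ {i} (i∈S : i ∈ S) → apply i i∈S ∈ C
    injective : ∀ {i j} (i∈S : i ∈ S) (j∈S : j ∈ S) → apply i i∈S ≡ apply j j∈S → i ≡ j

open SubsetInjection

module _ {a b} {S : Subset a} {C : Subset b} where

  tail : ∀ {x} → SubsetInjection (x ∷ S) C → SubsetInjection S C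
  tail f = record
    { apply     = λ i i∈S → apply f (Fin.suc i) (there i∈S)
    ; apply-∈   = λ i∈S → apply-∈ f (there i∈S)
    ; injective = λ i∈S j∈S eq → Finₚ.suc-injective (injective f (there i∈S) (there j∈S) eq)
    }

  avoiding : ∀ {q} (f : SubsetInjection S C) → (∀ {i} (i∈S : i ∈ S) → apply f i i∈S ≢ q) →
             SubsetInjection S (C - q)
  avoiding f misses = record
    { apply     = apply f
    ; apply-∈   = λ i∈S → x∈p∧x≢y⇒x∈p-y (apply-∈ f i∈S) (misses i∈S)
    ; injective = injective f
    }

  behead : (f : SubsetInjection (inside ∷ S) C) → SubsetInjection S (C - apply f Fin.zero here)
  behead f = avoiding (tail f) λ i∈S eq → Finₚ.0≢1+n (sym (injective f (there i∈S) here eq))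

injection⇒∣∣≤ : ∀ {a b} {S : Subset a} {C : Subset b} → SubsetInjection S C → ∣ S ∣ ≤ ∣ C ∣
injection⇒∣∣≤ {S = []}          f = z≤n
injection⇒∣∣≤ {S = outside ∷ S} f = injection⇒∣∣≤ (tail f)
injection⇒∣∣≤ {S = inside ∷ S} {C} f = begin-strict
  ∣ S ∣                         ≤⟨ injection⇒∣∣≤ (behead f) ⟩
  ∣ C - apply f Fin.zero here ∣ <⟨ x∈p⇒∣p-x∣<∣p∣ (apply-∈ f here) ⟩
  ∣ C ∣                         ∎
  where open ≤-Reasoning

injection-surjective : ∀ {a b} {S : Subset a} {C : Subset b} (f : SubsetInjection S C) →
                       ∣ C ∣ ≤ ∣ S ∣ → ∀ {q} → q ∈ C → ∃[ i ] Σ (i ∈ S) λ i∈S → apply f i i∈S ≡ q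
injection-surjective {S = []} f ∣C∣≤0 q∈C = contradiction (<-≤-trans (x∈p⇒∣p-x∣<∣p∣ q∈C) ∣C∣≤0) n≮0
injection-surjective {S = outside ∷ S} f ∣C∣≤∣S∣ q∈C with injection-surjective (tail f) ∣C∣≤∣S∣ q∈C
... | i , i∈S , eq = Fin.suc i , there i∈S , eq
injection-surjective {S = inside ∷ S} {C} f ∣C∣≤1+∣S∣ {q} q∈C with apply f Fin.zero here Finₚ.≟ q
... | yes eq = Fin.zero , here , eq
... | no neq with injection-surjective (behead f) ∣C-f₀∣≤∣S∣ (x∈p∧x≢y⇒x∈p-y q∈C (neq ∘ sym))
  where
  ∣C-f₀∣≤∣S∣ : ∣ C - apply f Fin.zero here ∣ ≤ ∣ S ∣
  ∣C-f₀∣≤∣S∣ = s≤s⁻¹ (≤-trans (x∈p⇒∣p-x∣<∣p∣ (apply-∈ f here)) ∣C∣≤1+∣S∣)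
...   | i , i∈S , eq = Fin.suc i , there i∈S , eq

module IncidenceGraph (Γ : Geometry) where

  adj-sym : ∀ {x y} → Adj Γ x y → Adj Γ y x
  adj-sym {inj₁ _} {inj₂ _} h = h
  adj-sym {inj₂ _} {inj₁ _} h = h

  isPoint : Elem Γ → Bool
  isPoint (inj₁ _) = true
  isPoint (inj₂ _) = false

  adj-isPoint : ∀ {x y} → Adj Γ x y → isPoint y ≡ not (isPoint x)
  adj-isPoint {inj₁ _} {inj₂ _} _ = refl
  adj-isPoint {inj₂ _} {inj₁ _} _ = refl

  walk-isPoint : ∀ {x z n} → Walk Γ x z n → isPoint z ≡ iterate not (isPoint x) n
  walk-isPoint here = refl
  walk-isPoint {x} (step {y = y} {n = n} h w) =
    trans (walk-isPoint w) (cong (λ b → iterate not b n) (adj-isPoint {x} {y} h))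

  walk-parity : ∀ {x z n} → Walk Γ x z n → ¬ Walk Γ x z (suc n)
  walk-parity {x} {z} {n} w w′ = not-¬ refl (begin
    fold b not n             ≡⟨ iterate-is-fold b not n ⟩
    iterate not b n          ≡⟨ walk-isPoint w ⟨
    isPoint z                ≡⟨ walk-isPoint w′ ⟩
    iterate not b (suc n)    ≡⟨ iterate-is-fold b not (suc n) ⟨
    not (fold b not n)       ∎)
    where
    open ≡-Reasoning
    b : Bool
    b = isPoint x

  _++_ : ∀ {x y z i j} → Walk Γ x y i → Walk Γ y z j → Walk Γ x z (i + j)
  here     ++ w′ = w′
  step h w ++ w′ = step h (w ++ w′)

  NoShorterWalk : Elem Γ → Elem Γ → ℕ → Set
  NoShorterWalk x z n = ∀ j → j < n → ¬ Walk Γ x z j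

  ¬Dist≤⇒NoShorterWalk : ∀ {x z n} → (∀ i → i + 2 ≡ suc n → ¬ Dist≤ Γ x z i) → NoShorterWalk x z n
  ¬Dist≤⇒NoShorterWalk {n = suc i} none j (s≤s j≤i) w = none i (+-comm i 2) (j , j≤i , w)

  NoShorterWalk-suc : ∀ {x z n} → NoShorterWalk x z n → Walk Γ x z (suc n) → NoShorterWalk x z (suc n)
  NoShorterWalk-suc none w j j<1+n w′ with m≤n⇒m<n∨m≡n (s≤s⁻¹ j<1+n)
  ... | inj₁ j<n  = none j j<n w′
  ... | inj₂ refl = walk-parity w′ w

  Dist≡-unique : ∀ {x z i j} → Dist≡ Γ x z i → Dist≡ Γ x z j → i ≡ j
  Dist≡-unique (wᵢ , noneᵢ) (wⱼ , noneⱼ) =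
    ≤-antisym (≮⇒≥ λ j<i → noneᵢ _ j<i wⱼ) (≮⇒≥ λ i<j → noneⱼ _ i<j wᵢ)

  Dist≡0⇒≡ : ∀ {x z} → Dist≡ Γ x z 0 → x ≡ z
  Dist≡0⇒≡ (here , _) = refl

  vertex : ∀ {x z n} → Walk Γ x z n → ℕ → Elem Γ
  vertex {x} here       _       = x
  vertex {x} (step _ _) zero    = x
  vertex     (step _ w) (suc i) = vertex w i

  vertex-zero : ∀ {x z n} (w : Walk Γ x z n) → vertex w 0 ≡ x
  vertex-zero here       = refl
  vertex-zero (step _ _) = refl

  vertex-end : ∀ {x z n} (w : Walk Γ x z n) → vertex w n ≡ z
  vertex-end here       = refl
  vertex-end (step _ w) = vertex-end w

  vertex-adj : ∀ {x z n} (w : Walk Γ x z n) {i} → i < n → Adj Γ (vertex w i) (vertex w (suc i))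
  vertex-adj {x} (step h w) {zero}  _         = subst (Adj Γ x) (sym (vertex-zero w)) h
  vertex-adj     (step h w) {suc i} (s≤s i<n) = vertex-adj w i<n

  prefix : ∀ {x z n} (w : Walk Γ x z n) {i} → i ≤ n → Walk Γ x (vertex w i) i
  prefix here       {zero}  _         = here
  prefix (step _ _) {zero}  _         = here
  prefix (step h w) {suc i} (s≤s i≤n) = step h (prefix w i≤n)

  suffix : ∀ {x z n} (w : Walk Γ x z n) {i} → i ≤ n → Walk Γ (vertex w i) z (n ∸ i)
  suffix here       {zero}  _         = here
  suffix (step h w) {zero}  _         = step h w
  suffix (step _ w) {suc i} (s≤s i≤n) = suffix w i≤n

  geodesic-prefix : ∀ {x z n} (w : Walk Γ x z n) → NoShorterWalk x z n →
                    ∀ {i} → i ≤ n → Dist≡ Γ x (vertex w i) i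
  geodesic-prefix {n = n} w none {i} i≤n = prefix w i≤n , shortcut
    where
    shortcut : NoShorterWalk _ (vertex w i) i
    shortcut j j<i w′ = none (j + (n ∸ i))
      (subst (j + (n ∸ i) <_) (m+[n∸m]≡n i≤n) (+-monoˡ-< (n ∸ i) j<i))
      (w′ ++ suffix w i≤n)

  toℕ-csuc : ∀ {n} (i : Fin n) →
             toℕ (csuc Γ i) ≡ suc (toℕ i) ⊎ (toℕ (csuc Γ i) ≡ 0 × suc (toℕ i) ≡ n)
  toℕ-csuc {suc n} i with m≤n⇒m<n∨m≡n (toℕ<n i)
  ... | inj₁ i+1<n = inj₁ (trans (toℕ-fromℕ< _) (m<n⇒m%n≡m i+1<n))
  ... | inj₂ i+1≡n = inj₂ (trans (toℕ-fromℕ< _) (trans (cong (_% suc n) i+1≡n) (n%n≡0 (suc n))) , i+1≡n)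

  closedWalk⇒OrdinaryGon : ∀ {k} (V : ℕ → Elem Γ) →
    (∀ {m m′} → m < 2 * k → m′ < 2 * k → V m ≡ V m′ → m ≡ m′) →
    (∀ {m} → m < 2 * k → Adj Γ (V m) (V (suc m))) →
    V (2 * k) ≡ V 0 → OrdinaryGon Γ k
  closedWalk⇒OrdinaryGon V V-injective V-adj closed = record
    { vert  = V ∘ toℕ
    ; inj   = λ eq → toℕ-injective (V-injective (toℕ<n _) (toℕ<n _) eq)
    ; cycle = cycle
    }
    where
    cycle : ∀ i → Adj Γ (V (toℕ i)) (V (toℕ (csuc Γ i)))
    cycle i with toℕ-csuc i
    ... | inj₁ next         = subst (Adj Γ (V (toℕ i)) ∘ V) (sym next) (V-adj (toℕ<n i))
    ... | inj₂ (wrap , end) = subst (Adj Γ (V (toℕ i)))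
                                (trans (cong V end) (trans closed (cong V (sym wrap))))
                                (V-adj (toℕ<n i))

  -- The cycle a 0, a 1, …, a J = b J, b (J-1), …, b 1 (with a 0 = x = b 0). It is injective
  -- because each vertex's distance from x pins down its position on a or on b.
  module TwoGeodesics {x : Elem Γ} {a b : ℕ → Elem Γ} {J : ℕ}
    (a-dist : ∀ {i} → i ≤ J → Dist≡ Γ x (a i) i)
    (b-dist : ∀ {i} → i ≤ J → Dist≡ Γ x (b i) i)
    (a-adj  : ∀ {i} → i < J → Adj Γ (a i) (a (suc i)))
    (b-adj  : ∀ {i} → i < J → Adj Γ (b i) (b (suc i)))
    (meet   : a J ≡ b J)
    (apart  : ∀ {i} → 0 < i → i < J → a i ≢ b i)
    where

    N : ℕ
    N = 2 * J

    N∸J≡J : N ∸ J ≡ J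
    N∸J≡J = trans (m+n∸m≡n J (J + 0)) (+-identityʳ J)

    falling-index≤ : ∀ {m} → J ≤ m → N ∸ m ≤ J
    falling-index≤ {m} J≤m = subst (N ∸ m ≤_) N∸J≡J (∸-monoʳ-≤ N J≤m)

    falling-index< : ∀ {m} → J < m → m ≤ N → N ∸ m < J
    falling-index< {m} J<m m≤N = subst (N ∸ m <_) N∸J≡J (∸-monoʳ-< J<m m≤N)

    V : ℕ → Elem Γ
    V m with m ≤? J
    ... | yes _ = a m
    ... | no  _ = b (N ∸ m)

    V-rising : ∀ {m} → m ≤ J → V m ≡ a m
    V-rising {m} m≤J with m ≤? J
    ... | yes _   = refl
    ... | no  m≰J = contradiction m≤J m≰J

    V-falling : ∀ {m} → J ≤ m → V m ≡ b (N ∸ m)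
    V-falling {m} J≤m with m ≤? J
    ... | no _ = refl
    ... | yes m≤J with ≤-antisym m≤J J≤m
    ...   | refl = trans meet (cong b (sym N∸J≡J))

    V-dist-rising : ∀ {m} → m ≤ J → Dist≡ Γ x (V m) m
    V-dist-rising m≤J = subst (λ v → Dist≡ Γ x v _) (sym (V-rising m≤J)) (a-dist m≤J)

    V-dist-falling : ∀ {m} → J ≤ m → Dist≡ Γ x (V m) (N ∸ m)
    V-dist-falling J≤m = subst (λ v → Dist≡ Γ x v _) (sym (V-falling J≤m)) (b-dist (falling-index≤ J≤m))

    V-adj : ∀ {m} → m < N → Adj Γ (V m) (V (suc m))
    V-adj {m} m<N with <-≤-connex m J
    ... | inj₁ m<J = subst₂ (Adj Γ) (sym (V-rising (<⇒≤ m<J))) (sym (V-rising m<J)) (a-adj m<J)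
    ... | inj₂ J≤m = subst₂ (Adj Γ) (sym (V-falling J≤m)) (sym (V-falling (m≤n⇒m≤1+n J≤m)))
                       (adj-sym {b r} {b (N ∸ m)}
                         (subst (λ i → Adj Γ (b r) (b i)) (sym (+-∸-assoc 1 m<N)) (b-adj r<J)))
      where
      r : ℕ
      r = N ∸ suc m
      r<J : r < J
      r<J = falling-index< (s≤s J≤m) m<N

    no-crossing : ∀ {m m′} → m ≤ J → J < m′ → m′ < N → V m ≢ V m′
    no-crossing {m} {m′} m≤J J<m′ m′<N eq = apart (m<n⇒0<n∸m m′<N) (falling-index< J<m′ (<⇒≤ m′<N)) (begin
      a r   ≡⟨ cong a m≡r ⟨
      a m   ≡⟨ V-rising m≤J ⟨
      V m   ≡⟨ eq ⟩
      V m′  ≡⟨ V-falling (<⇒≤ J<m′) ⟩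
      b r   ∎)
      where
      open ≡-Reasoning
      r : ℕ
      r = N ∸ m′
      m≡r : m ≡ r
      m≡r = Dist≡-unique (V-dist-rising m≤J) (subst (λ v → Dist≡ Γ x v r) (sym eq) (V-dist-falling (<⇒≤ J<m′)))

    V-injective : ∀ {m m′} → m < N → m′ < N → V m ≡ V m′ → m ≡ m′
    V-injective {m} {m′} m<N m′<N eq with ≤-<-connex m J | ≤-<-connex m′ J
    ... | inj₁ m≤J | inj₁ m′≤J = Dist≡-unique (V-dist-rising m≤J)
                                   (subst (λ v → Dist≡ Γ x v m′) (sym eq) (V-dist-rising m′≤J))
    ... | inj₂ J<m | inj₂ J<m′ = ∸-cancelˡ-≡ (<⇒≤ m<N) (<⇒≤ m′<N) (Dist≡-unique (V-dist-falling (<⇒≤ J<m))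
                                   (subst (λ v → Dist≡ Γ x v (N ∸ m′)) (sym eq) (V-dist-falling (<⇒≤ J<m′))))
    ... | inj₁ m≤J | inj₂ J<m′ = contradiction eq (no-crossing m≤J J<m′ m′<N)
    ... | inj₂ J<m | inj₁ m′≤J = contradiction (sym eq) (no-crossing m′≤J J<m m<N)

    V-closed : V N ≡ V 0
    V-closed = begin
      V N        ≡⟨ V-falling (m≤m+n J _) ⟩
      b (N ∸ N)  ≡⟨ cong b (n∸n≡0 N) ⟩
      b 0        ≡⟨ Dist≡0⇒≡ (b-dist z≤n) ⟨
      x          ≡⟨ Dist≡0⇒≡ (a-dist z≤n) ⟩
      a 0        ≡⟨ V-rising z≤n ⟨
      V 0        ∎
      where open ≡-Reasoning

    ordinaryGon : OrdinaryGon Γ J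
    ordinaryGon = closedWalk⇒OrdinaryGon V V-injective V-adj V-closed

  module _ {k} (noSmall : ∀ j → 2 ≤ j → j < k → ¬ OrdinaryGon Γ j) where

    shortest-walks-agree : ∀ {x z d} → suc d < k → NoShorterWalk x z (suc d) →
                           (u u′ : Walk Γ x z (suc d)) → vertex u 1 ≡ vertex u′ 1
    shortest-walks-agree {d = d} d<k none u u′
      with least-witness (λ i → ≡-dec Finₚ._≟_ Finₚ._≟_ (vertex u (suc i)) (vertex u′ (suc i)))
                         (trans (vertex-end u) (sym (vertex-end u′)))
    ... | zero  , _     , agree , _      = agree
    ... | suc j , j<d , meet  , before =
      contradiction (TwoGeodesics.ordinaryGon
                       (λ i≤J → geodesic-prefix u  none (≤-trans i≤J J≤1+d))
                       (λ i≤J → geodesic-prefix u′ none (≤-trans i≤J J≤1+d))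
                       (λ i<J → vertex-adj u  (<-≤-trans i<J J≤1+d))
                       (λ i<J → vertex-adj u′ (<-≤-trans i<J J≤1+d))
                       meet apart)
                    (noSmall _ (s≤s (s≤s z≤n)) (≤-<-trans J≤1+d d<k))
      where
      J≤1+d : suc (suc j) ≤ suc d
      J≤1+d = s≤s j<d
      apart : ∀ {i} → 0 < i → i < suc (suc j) → vertex u i ≢ vertex u′ i
      apart {suc i} _ (s≤s i<1+j) = before i<1+j

    geodesic-head-unique : ∀ {x y y′ z d} → suc d < k → NoShorterWalk x z (suc d) →
                           Adj Γ x y → Walk Γ y z d → Adj Γ x y′ → Walk Γ y′ z d → y ≡ y′
    geodesic-head-unique {y = y} {y′} d<k none h w h′ w′ = begin
      y             ≡⟨ vertex-zero w ⟨
      vertex w 0    ≡⟨ shortest-walks-agree d<k none (step h w) (step h′ w′) ⟩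
      vertex w′ 0   ≡⟨ vertex-zero w′ ⟩
      y′            ∎
      where open ≡-Reasoning

    module Choice (C : Subset (Geometry.np Γ)) (x : Elem Γ) (d : ℕ) (d<k : suc d < k)
      (near : ∀ p → p ∈ C → ∀ i → i + 2 ≡ suc d → ¬ Dist≤ Γ x (inj₁ p) i)
      (far  : ∀ y → Γ₁ Γ x y → Σ _ λ p → p ∈ C × InP Γ d y p)
      where

      chosen : ∀ {y} → Adj Γ x y → Fin (Geometry.np Γ)
      chosen {y} h = proj₁ (far y h)

      chosen-∈ : ∀ {y} (h : Adj Γ x y) → chosen h ∈ C
      chosen-∈ {y} h = proj₁ (proj₂ (far y h))

      chosen-walk : ∀ {y} (h : Adj Γ x y) → Walk Γ y (inj₁ (chosen h)) d
      chosen-walk {y} h = proj₁ (proj₂ (proj₂ (far y h)))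

      chosen-dist : ∀ {y} (h : Adj Γ x y) → InP Γ (suc d) x (chosen h)
      chosen-dist h = step h (chosen-walk h) ,
        NoShorterWalk-suc (¬Dist≤⇒NoShorterWalk (near _ (chosen-∈ h))) (step h (chosen-walk h))

      chosen-injective : ∀ {y y′} (h : Adj Γ x y) (h′ : Adj Γ x y′) → chosen h ≡ chosen h′ → y ≡ y′
      chosen-injective {y′ = y′} h h′ eq = geodesic-head-unique d<k (proj₂ (chosen-dist h)) h (chosen-walk h) h′
        (subst (λ p → Walk Γ y′ (inj₁ p) d) (sym eq) (chosen-walk h′))

      module _ {a} (S : Subset a) (element : Fin a → Elem Γ) (element-injective : Injective _≡_ _≡_ element)
               (S⇒adj : ∀ {i} → i ∈ S → Adj Γ x (element i)) where

        choiceInjection : SubsetInjection S C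
        choiceInjection = record
          { apply     = λ _ i∈S → chosen (S⇒adj i∈S)
          ; apply-∈   = λ i∈S → chosen-∈ (S⇒adj i∈S)
          ; injective = λ i∈S j∈S eq → element-injective (chosen-injective (S⇒adj i∈S) (S⇒adj j∈S) eq)
          }

        ∣C∣≤∣S∣⇒C⊆𝒫 : ∣ C ∣ ≤ ∣ S ∣ → ∀ q → q ∈ C → InP Γ (suc d) x q
        ∣C∣≤∣S∣⇒C⊆𝒫 ∣C∣≤∣S∣ _ q∈C with injection-surjective choiceInjection ∣C∣≤∣S∣ q∈C
        ... | _ , i∈S , refl = chosen-dist (S⇒adj i∈S)

≤2m∸2⇒<2m : ∀ {m d} → 2 ≤ m → d ≤ 2 * m ∸ 2 → d < 2 * m
≤2m∸2⇒<2m {m} 2≤m d≤2m-2 = ≤-<-trans d≤2m-2 (∸-monoʳ-< (s≤s z≤n) (≤-trans 2≤m (m≤m+n m _)))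

lemma2p12 : (Γ : Geometry) (m s t : ℕ) →
    2 ≤ m → WeakGenPolygon Γ (2 * m) → HasOrder Γ s t → s ≤ t →
    (C : Subset (Geometry.np Γ)) → ∣ C ∣ ≡ suc s →
    (x : Elem Γ) (d : ℕ) → 1 ≤ d → d ≤ 2 * m ∸ 2 →
    (∀ p → p ∈ C → ∀ i → i + 2 ≡ d → ¬ Dist≤ Γ x (inj₁ p) i) →
    (∀ y → Γ₁ Γ x y → Σ _ λ p → p ∈ C × InP Γ (d ∸ 1) y p) →
    (∀ p → p ∈ C → InP Γ d x p) × (IsPoint Γ x → s ≡ t)
lemma2p12 Γ m s t 2≤m polygon (_ , pointOrder) s≤t C ∣C∣≡1+s (inj₁ p) (suc d) _ d≤2m-2 near far =
  ∣C∣≤∣S∣⇒C⊆𝒫 S inj₂ inj₂-injective ∈-tabulate⁻ ∣C∣≤∣S∣ , λ _ → ≤-antisym s≤t (s≤s⁻¹ 1+t≤1+s)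
  where
  open IncidenceGraph Γ
  open Choice (WeakGenPolygon.noSmall polygon) C (inj₁ p) d (≤2m∸2⇒<2m 2≤m d≤2m-2) near far
  S : Subset (Geometry.nl Γ)
  S = linesThrough Γ p
  ∣C∣≤∣S∣ : ∣ C ∣ ≤ ∣ S ∣
  ∣C∣≤∣S∣ = subst₂ _≤_ (sym ∣C∣≡1+s) (sym (pointOrder p)) (s≤s s≤t)
  1+t≤1+s : suc t ≤ suc s
  1+t≤1+s = subst₂ _≤_ (pointOrder p) ∣C∣≡1+s (injection⇒∣∣≤ (choiceInjection S inj₂ inj₂-injective ∈-tabulate⁻))
lemma2p12 Γ m s t 2≤m polygon (lineOrder , _) s≤t C ∣C∣≡1+s (inj₂ L) (suc d) _ d≤2m-2 near far =
  ∣C∣≤∣S∣⇒C⊆𝒫 S inj₁ inj₁-injective ∈-tabulate⁻ (≤-reflexive (trans ∣C∣≡1+s (sym (lineOrder L)))) , λ ()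
  where
  open IncidenceGraph Γ
  open Choice (WeakGenPolygon.noSmall polygon) C (inj₂ L) d (≤2m∸2⇒<2m 2≤m d≤2m-2) near far
  S : Subset (Geometry.np Γ)
  S = pointsOn Γ L
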